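{- Let $P$ be a finite partially ordered set and let $f$ be an irreducible element of the monoid $\mathrm{M}(P)$. Assume that the support of $f$ is not contained in the union of the supports of the other irreducible elements of $\mathrm{M}(P)$. Then $f$ is prime in $\mathrm{M}(P)$.
   Context: $\mathrm{M}(P)$ is the monoid under pointwise addition of monotone functions $P\to\mathbb{N}$. An irreducible element is a nonzero element that is not the sum of two nonzero elements. $\operatorname{supp}(f)=\{p\in P\mid f(p)\neq0\}$. $a$ is prime if whenever $b+c=a+d$ with $b,c,d\in\mathrm{M}(P)$, there is $e\in\mathrm{M}(P)$ with $b=a+e$ or $c=a+e$. -}

module Defs where

open import Level using (0ℓ)
open import Data.Nat using (ℕ; _+_) renaming (_≤_ to _≤ℕ_)
open import Data.Fin using (Fin)
open import Data.Product using (Σ; ∃; _×_)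
open import Data.Sum using (_⊎_)
open import Relation.Nullary using (¬_)
open import Relation.Binary using (Rel; Decidable; IsPartialOrder)
open import Relation.Binary.PropositionalEquality using (_≡_)

record FinPoset : Set₁ where
  field
    size   : ℕ
    _≤_    : Rel (Fin size) 0ℓ
    isPartialOrder : IsPartialOrder _≡_ _≤_
    _≤?_   : Decidable _≤_

module _ (P : FinPoset) where
  open FinPoset P

  record M : Set where
    constructor mk
    field
      fun      : Fin size → ℕ
      monotone : ∀ {p q} → p ≤ q → fun p ≤ℕ fun q
  open M public

  _≈_ : M → M → Set
  f ≈ g = ∀ p → fun f p ≡ fun g p

  _⊕_ : M → M → M
  f ⊕ g = mk (λ p → fun f p + fun g p)
             (λ p≤q → Data.Nat.Properties.+-mono-≤ (monotone f p≤q) (monotone g p≤q))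
    where import Data.Nat.Properties

  𝟘 : M
  𝟘 = mk (λ _ → 0) (λ _ → Data.Nat.z≤n)
    where import Data.Nat

  NonZero : M → Set
  NonZero f = ¬ (f ≈ 𝟘)

  InSupp : Fin size → M → Set
  InSupp p f = ¬ (fun f p ≡ 0)

  Irreducible : M → Set
  Irreducible f = NonZero f × (∀ g h → NonZero g → NonZero h → ¬ (f ≈ (g ⊕ h)))

  Prime : M → Set
  Prime a = ∀ b c d → (b ⊕ c) ≈ (a ⊕ d) →
            (∃ λ e → b ≈ (a ⊕ e)) ⊎ (∃ λ e → c ≈ (a ⊕ e))

  SuppNotCovered : M → Set
  SuppNotCovered f = ∃ λ p → InSupp p f ×
    (∀ g → Irreducible g → ¬ (g ≈ f) → ¬ InSupp p g)

-- Let p ∈ supp f lie in the support of no other irreducible. The indicator of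
-- the up-set ↑p is irreducible and has p in its support, so f = χ ↑p. If
-- q ≤ r ≥ p, the indicator of ↑q ∪ ↑p is irreducible too (both generators lie
-- below r) and again has p in its support, so it equals χ ↑p, which forces
-- p ≤ q: the up-set ↑p is also down-closed. For such a set, any monotone b
-- with b(p) ≥ 1 splits as χ ↑p + (b − χ ↑p) with b − χ ↑p still monotone.
-- Finally b + c = f + d gives b(p) ≥ 1 or c(p) ≥ 1.
module Submission where

open import Level using (0ℓ)
open import Defs
open import Data.Nat using (ℕ; suc; _+_; _∸_; z≤n; s≤s) renaming (_≤_ to _≤ℕ_)
open import Data.Nat.Properties
  using (_≟_; suc-injective; m+n≡0⇒m≡0; m+n≡0⇒n≡0; n≢0⇒n>0; n≤0⇒n≡0;
         +-comm; +-identityʳ; ≤-trans; ≤-reflexive; ∸-monoˡ-≤; m+[n∸m]≡n)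
open import Data.Fin using (Fin)
open import Data.Product using (∃-syntax; _×_; _,_)
open import Data.Sum using (inj₁; inj₂)
open import Relation.Nullary using (¬_; yes; no; contradiction)
open import Relation.Nullary.Decidable using (decidable-stable)
open import Relation.Unary using (Pred; _∈_; _∉_; _∪_)
import Relation.Unary as Unary
open import Relation.Unary.Properties using (_∪?_)
open import Relation.Binary using (IsPartialOrder)
open import Relation.Binary.PropositionalEquality using (_≡_; refl; sym; trans; cong; cong₂; subst)
open Relation.Binary.PropositionalEquality.≡-Reasoning

1≤m⇒m+n≡1⇒n≡0 : ∀ {m n} → 1 ≤ℕ m → m + n ≡ 1 → n ≡ 0
1≤m⇒m+n≡1⇒n≡0 {suc m} (s≤s _) m+n≡1 = m+n≡0⇒n≡0 m (suc-injective m+n≡1)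

module _ (P : FinPoset) where
  open FinPoset P
  open IsPartialOrder isPartialOrder using () renaming (refl to ≤ᴾ-refl; trans to ≤ᴾ-trans)

  ≈-stable : ∀ {f g : M P} → ¬ ¬ _≈_ P f g → _≈_ P f g
  ≈-stable {f} {g} ¬¬f≈g x =
    decidable-stable (fun f x ≟ fun g x) (λ fx≢gx → ¬¬f≈g (λ f≈g → fx≢gx (f≈g x)))

  record UpSet : Set₁ where
    field
      set      : Pred (Fin size) 0ℓ
      decide   : Unary.Decidable set
      upClosed : ∀ {x y} → x ≤ y → x ∈ set → y ∈ set
  open UpSet

  ↑_ : Fin size → UpSet
  ↑ p = record { set = p ≤_ ; decide = p ≤?_ ; upClosed = λ x≤y p≤x → ≤ᴾ-trans p≤x x≤y }

  _∪ᵘ_ : UpSet → UpSet → UpSet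
  U ∪ᵘ V = record
    { set      = set U ∪ set V
    ; decide   = decide U ∪? decide V
    ; upClosed = λ { x≤y (inj₁ x∈U) → inj₁ (upClosed U x≤y x∈U)
                   ; x≤y (inj₂ x∈V) → inj₂ (upClosed V x≤y x∈V) }
    }

  DownClosed : UpSet → Set
  DownClosed U = ∀ {x y} → x ≤ y → y ∈ set U → x ∈ set U

  GeneratedBelow : UpSet → Fin size → Set
  GeneratedBelow U r = ∀ {x} → x ∈ set U → ∃[ s ] s ∈ set U × s ≤ x × s ≤ r

  indicator : UpSet → Fin size → ℕ
  indicator U x with decide U x
  ... | yes _ = 1
  ... | no _  = 0

  indicator-∈ : ∀ U {x} → x ∈ set U → indicator U x ≡ 1
  indicator-∈ U {x} x∈U with decide U x
  ... | yes _   = refl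
  ... | no x∉U = contradiction x∈U x∉U

  indicator-∉ : ∀ U {x} → x ∉ set U → indicator U x ≡ 0
  indicator-∉ U {x} x∉U with decide U x
  ... | yes x∈U = contradiction x∈U x∉U
  ... | no _    = refl

  indicator-mono : ∀ U {x y} → x ≤ y → indicator U x ≤ℕ indicator U y
  indicator-mono U {x} x≤y with decide U x
  ... | yes x∈U = ≤-reflexive (sym (indicator-∈ U (upClosed U x≤y x∈U)))
  ... | no _    = z≤n

  χ : UpSet → M P
  χ U = mk (indicator U) (indicator-mono U)

  ∈⇒InSupp-χ : ∀ U {x} → x ∈ set U → InSupp P x (χ U)
  ∈⇒InSupp-χ U x∈U χx≡0 = contradiction (trans (sym (indicator-∈ U x∈U)) χx≡0) λ ()

  InSupp-χ⇒∈ : ∀ U {x} → InSupp P x (χ U) → x ∈ set U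
  InSupp-χ⇒∈ U {x} χx≢0 with decide U x
  ... | yes x∈U = x∈U
  ... | no _    = contradiction refl χx≢0

  -- A summand vanishing at r vanishes below r, so the other summand carries
  -- all of χ U on the generators, hence (being monotone) on all of U.
  χ-summand-vanishes : ∀ U r → GeneratedBelow U r → (g h : M P) →
                       _≈_ P (χ U) (_⊕_ P g h) → fun h r ≡ 0 → _≈_ P h (𝟘 P)
  χ-summand-vanishes U r below g h χ≈g⊕h hr≡0 x with decide U x
  ... | no x∉U = m+n≡0⇒n≡0 (fun g x) (trans (sym (χ≈g⊕h x)) (indicator-∉ U x∉U))
  ... | yes x∈U with below x∈U
  ...   | s , s∈U , s≤x , s≤r =
    1≤m⇒m+n≡1⇒n≡0 (≤-trans (≤-reflexive (sym gs≡1)) (monotone g s≤x))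
                  (trans (sym (χ≈g⊕h x)) (indicator-∈ U x∈U))
    where
    hs≡0 : fun h s ≡ 0
    hs≡0 = n≤0⇒n≡0 (subst (fun h s ≤ℕ_) hr≡0 (monotone h s≤r))
    gs≡1 : fun g s ≡ 1
    gs≡1 = begin
      fun g s              ≡⟨ sym (+-identityʳ (fun g s)) ⟩
      fun g s + 0          ≡⟨ cong (fun g s +_) (sym hs≡0) ⟩
      fun g s + fun h s    ≡⟨ sym (χ≈g⊕h s) ⟩
      indicator U s        ≡⟨ indicator-∈ U s∈U ⟩
      1                    ∎

  χ-irreducible : ∀ U r → r ∈ set U → GeneratedBelow U r → Irreducible P (χ U)
  χ-irreducible U r r∈U below = (λ χ≈𝟘 → ∈⇒InSupp-χ U r∈U (χ≈𝟘 r)) , indecomposable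
    where
    indecomposable : ∀ g h → NonZero P g → NonZero P h → ¬ _≈_ P (χ U) (_⊕_ P g h)
    indecomposable g h g≉𝟘 h≉𝟘 χ≈g⊕h with fun h r ≟ 0
    ... | yes hr≡0 = h≉𝟘 (χ-summand-vanishes U r below g h χ≈g⊕h hr≡0)
    ... | no hr≢0  = g≉𝟘 (χ-summand-vanishes U r below h g χ≈h⊕g gr≡0)
      where
      χ≈h⊕g : _≈_ P (χ U) (_⊕_ P h g)
      χ≈h⊕g x = trans (χ≈g⊕h x) (+-comm (fun g x) (fun h x))
      gr≡0 : fun g r ≡ 0
      gr≡0 = 1≤m⇒m+n≡1⇒n≡0 (n≢0⇒n>0 hr≢0) (trans (sym (χ≈h⊕g r)) (indicator-∈ U r∈U))

  χ-divides : ∀ U → DownClosed U → (b : M P) → (∀ {x} → x ∈ set U → 1 ≤ℕ fun b x) →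
              ∃[ e ] _≈_ P b (_⊕_ P (χ U) e)
  χ-divides U downClosed b b≥1 = mk (λ x → fun b x ∸ indicator U x) difference-mono , split
    where
    χ≤b : ∀ x → indicator U x ≤ℕ fun b x
    χ≤b x with decide U x
    ... | yes x∈U = b≥1 x∈U
    ... | no _    = z≤n
    difference-mono : ∀ {x y} → x ≤ y → fun b x ∸ indicator U x ≤ℕ fun b y ∸ indicator U y
    difference-mono {x} {y} x≤y with decide U x | decide U y
    ... | yes _   | yes _   = ∸-monoˡ-≤ 1 (monotone b x≤y)
    ... | yes x∈U | no y∉U  = contradiction (upClosed U x≤y x∈U) y∉U
    ... | no x∉U  | yes y∈U = contradiction (downClosed x≤y y∈U) x∉U
    ... | no _    | no _    = monotone b x≤y
    split : ∀ x → fun b x ≡ indicator U x + (fun b x ∸ indicator U x)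
    split x = sym (m+[n∸m]≡n (χ≤b x))

  module Uncovered (f : M P) (p : Fin size) (p∈supp : InSupp P p f)
                   (uncovered : ∀ g → Irreducible P g → ¬ _≈_ P g f → ¬ InSupp P p g) where

    irreducible-at-p≈f : ∀ g → Irreducible P g → InSupp P p g → _≈_ P g f
    irreducible-at-p≈f g g-irr p∈g = ≈-stable {g} {f} (λ g≉f → uncovered g g-irr g≉f p∈g)

    χ↑p≈f : _≈_ P (χ (↑ p)) f
    χ↑p≈f = irreducible-at-p≈f (χ (↑ p))
      (χ-irreducible (↑ p) p ≤ᴾ-refl (λ {x} p≤x → p , ≤ᴾ-refl , p≤x , ≤ᴾ-refl))
      (∈⇒InSupp-χ (↑ p) ≤ᴾ-refl)

    ↑p-downClosed : DownClosed (↑ p)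
    ↑p-downClosed {q} {r} q≤r p≤r = InSupp-χ⇒∈ (↑ p) χ↑p-at-q≢0
      where
      ↑q∪↑p≈f : _≈_ P (χ ((↑ q) ∪ᵘ (↑ p))) f
      ↑q∪↑p≈f = irreducible-at-p≈f (χ ((↑ q) ∪ᵘ (↑ p)))
        (χ-irreducible ((↑ q) ∪ᵘ (↑ p)) r (inj₂ p≤r)
          (λ { (inj₁ q≤x) → q , inj₁ ≤ᴾ-refl , q≤x , q≤r
             ; (inj₂ p≤x) → p , inj₂ ≤ᴾ-refl , p≤x , p≤r }))
        (∈⇒InSupp-χ ((↑ q) ∪ᵘ (↑ p)) (inj₂ ≤ᴾ-refl))
      χ↑p-at-q≢0 : InSupp P q (χ (↑ p))
      χ↑p-at-q≢0 χ↑p-at-q≡0 = ∈⇒InSupp-χ ((↑ q) ∪ᵘ (↑ p)) (inj₁ ≤ᴾ-refl)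
        (trans (↑q∪↑p≈f q) (trans (sym (χ↑p≈f q)) χ↑p-at-q≡0))

    f-divides : (b : M P) → InSupp P p b → ∃[ e ] _≈_ P b (_⊕_ P f e)
    f-divides b p∈b with χ-divides (↑ p) ↑p-downClosed b
                           (λ p≤x → ≤-trans (n≢0⇒n>0 p∈b) (monotone b p≤x))
    ... | e , b≈χ↑p⊕e = e , λ x → trans (b≈χ↑p⊕e x) (cong (_+ fun e x) (χ↑p≈f x))

    f-prime : Prime P f
    f-prime b c d b⊕c≈f⊕d with fun b p ≟ 0
    ... | no p∈b    = inj₁ (f-divides b p∈b)
    ... | yes bp≡0 = inj₂ (f-divides c p∈c)
      where
      p∈c : InSupp P p c
      p∈c cp≡0 = p∈supp (m+n≡0⇒m≡0 (fun f p)
        (trans (sym (b⊕c≈f⊕d p)) (cong₂ _+_ bp≡0 cp≡0)))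

proposition15 : (P : FinPoset) (f : M P) → Irreducible P f → SuppNotCovered P f → Prime P f
proposition15 P f _ (p , p∈supp , uncovered) = Uncovered.f-prime P f p p∈supp uncovered
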